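{- Let $\alpha,\nu$ be positive integers with $\alpha>1$, and let $G\in E_1(\alpha,\nu)$. Then $|V(G)|\ge 2\nu+2$.
   Context: All graphs are finite and simple; $\alpha(G)$ denotes the independence number and $\nu(G)$ the size of a maximum matching. For positive integers $\alpha,\nu$, let $e_1(\alpha,\nu)=\max\{|E(G)|:\alpha(G)=\alpha,\ \nu(G)=\nu\}$ (the maximum exists since such $G$ has at most $2\nu+\alpha$ vertices), and let $E_1(\alpha,\nu)$ be the set of graphs $G$ with $\alpha(G)=\alpha$, $\nu(G)=\nu$ and $|E(G)|=e_1(\alpha,\nu)$. -}

module Defs where

open import Data.Nat using (ℕ; _≤_; _<_; _<?_)
open import Data.Bool using (Bool; true; false; T)
open import Data.Fin using (Fin; toℕ)
open import Data.Fin.Subset using (Subset; _∈_; ∣_∣)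
open import Data.List using (List; []; _∷_; length; filter; allFin; cartesianProduct; concatMap)
open import Data.List.Relation.Unary.All using (All)
open import Data.List.Relation.Unary.Unique.Propositional using (Unique)
open import Data.Product using (_×_; _,_; Σ; ∃)
open import Relation.Binary.PropositionalEquality using (_≡_)
open import Relation.Nullary.Decidable using (_×-dec_)
open import Data.Bool.Properties using (T?)

record Graph (n : ℕ) : Set where
  field
    adj   : Fin n → Fin n → Bool
    sym   : ∀ i j → adj i j ≡ adj j i
    loopless : ∀ i → adj i i ≡ false
open Graph public

Independent : ∀ {n} → Graph n → Subset n → Set
Independent G S = ∀ i j → i ∈ S → j ∈ S → adj G i j ≡ false

IndependenceNumber : ∀ {n} → Graph n → ℕ → Set
IndependenceNumber G a =
  (Σ (Subset _) λ S → Independent G S × ∣ S ∣ ≡ a) ×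
  (∀ S → Independent G S → ∣ S ∣ ≤ a)

endpoints : ∀ {n} → List (Fin n × Fin n) → List (Fin n)
endpoints = concatMap (λ { (u , v) → u ∷ v ∷ [] })

IsMatching : ∀ {n} → Graph n → List (Fin n × Fin n) → Set
IsMatching G M = All (λ { (u , v) → adj G u v ≡ true }) M × Unique (endpoints M)

MatchingNumber : ∀ {n} → Graph n → ℕ → Set
MatchingNumber G m =
  (Σ (List _) λ M → IsMatching G M × length M ≡ m) ×
  (∀ M → IsMatching G M → length M ≤ m)

edgeCount : ∀ {n} → Graph n → ℕ
edgeCount {n} G =
  length (filter (λ { (i , j) → (toℕ i <? toℕ j) ×-dec T? (adj G i j) })
                 (cartesianProduct (allFin n) (allFin n)))

InE₁ : ℕ → ℕ → ∀ {n} → Graph n → Set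
InE₁ a m G =
  IndependenceNumber G a × MatchingNumber G m ×
  (∀ k (H : Graph k) → IndependenceNumber H a → MatchingNumber H m →
     edgeCount H ≤ edgeCount G)

-- If G ∈ E₁(α, ν) had n ≤ 2ν + 1 vertices, consider the complete graph Kₙ together with α − 1
-- isolated vertices. Its independence number is α, and its matching number is ν: the matchings
-- of G embed into Kₙ, while every matching of Kₙ has at most ⌊n/2⌋ ≤ ν edges. Since α ≥ 2,
-- G misses some edge of Kₙ, so this graph has strictly more edges than G, contradicting the
-- maximality of G.
module Submission where

open import Defs hiding (sym)
open import Data.Nat using (ℕ; suc; _≤_; _<_; _+_; _*_; z≤n; s≤s; s≤s⁻¹; z<s; s<s; _≤?_)
open import Data.Nat.Properties
  using (+-suc; +-comm; *-suc; +-mono-≤; *-cancelˡ-<; ≮⇒≥; ≰⇒>; <⇒≢; <⇒≱; module ≤-Reasoning)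
open import Data.Bool using (Bool; true; false; not; T)
open import Data.Bool.Properties using (¬-not; T-≡)
open import Data.Fin using (Fin; zero; suc; toℕ; _↑ˡ_; splitAt; _≟_)
open import Data.Fin.Properties using (splitAt-↑ˡ; splitAt⁻¹-↑ˡ; toℕ-↑ˡ; ↑ˡ-injective)
open import Data.Fin.Subset using (Subset; _∈_; ∣_∣; Nonempty; inside; outside; ⁅_⁆; ⊤)
open import Data.Fin.Subset.Properties using (∣p∣≤n; ∣⁅x⁆∣≡1; ∣⊤∣≡n; x∈⁅y⁆⇒x≡y)
open import Data.List as List using (List; []; _∷_; length; map; filter; allFin; cartesianProduct)
open import Data.List.Properties using (length-++; length-map; length-tabulate)
open import Data.List.Membership.Propositional using () renaming (_∈_ to _∈ₗ_)
open import Data.List.Membership.Propositional.Properties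
  using (∈-∃++; ∈-++⁻; ∈-++⁺ˡ; ∈-++⁺ʳ; ∈-map⁺; ∈-map⁻; ∈-filter⁻; ∈-filter⁺; ∈-allFin;
         ∈-cartesianProduct⁺)
open import Data.List.Relation.Binary.Subset.Propositional using (_⊆_)
open import Data.List.Relation.Unary.All as All using (All; []; _∷_)
import Data.List.Relation.Unary.All.Properties as All
open import Data.List.Relation.Unary.Any using (here; there)
open import Data.List.Relation.Unary.AllPairs using ([]; _∷_)
open import Data.List.Relation.Unary.Unique.Propositional using (Unique)
import Data.List.Relation.Unary.Unique.Propositional.Properties as Unique
open import Data.Product using (_×_; _,_; proj₂; ∃₂)
import Data.Product as Product
open import Data.Product.Properties using (,-injective)
open import Data.Sum using (_⊎_; inj₁; inj₂)
open import Data.Vec using ([]; _∷_; _++_; here; there)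
open import Function using (Injective; _∘_)
open import Function.Bundles using (Equivalence)
open import Level using (0ℓ)
open import Relation.Binary.PropositionalEquality
  using (_≡_; _≢_; refl; trans; cong; cong₂; subst; subst₂) renaming (sym to ≡-sym)
open import Relation.Nullary using (¬_; yes; no; does; contradiction)
open import Relation.Nullary.Decidable using (dec-true; dec-false; decidable-stable)
open import Relation.Unary using (Pred; Decidable)

⊆⇒length≤ : {A : Set} {xs ys : List A} → Unique xs → xs ⊆ ys → length xs ≤ length ys
⊆⇒length≤ [] _ = z≤n
⊆⇒length≤ {xs = x ∷ xs} (x∉xs ∷ xs!) x∷xs⊆ys
  with us , vs , refl ← ∈-∃++ (x∷xs⊆ys (here refl)) = begin
    suc (length xs)              ≤⟨ s≤s (⊆⇒length≤ xs! xs⊆us++vs) ⟩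
    suc (length (us List.++ vs)) ≡⟨ cong suc (length-++ us) ⟩
    suc (length us + length vs)  ≡⟨ +-suc (length us) (length vs) ⟨
    length us + length (x ∷ vs)  ≡⟨ length-++ us ⟨
    length (us List.++ x ∷ vs)   ∎
  where
  open ≤-Reasoning
  xs⊆us++vs : xs ⊆ us List.++ vs
  xs⊆us++vs z∈xs with ∈-++⁻ us (x∷xs⊆ys (there z∈xs))
  ... | inj₁ z∈us         = ∈-++⁺ˡ z∈us
  ... | inj₂ (here refl)  = contradiction refl (All.lookup x∉xs z∈xs)
  ... | inj₂ (there z∈vs) = ∈-++⁺ʳ us z∈vs

module _ {A B : Set} {P : Pred A 0ℓ} {Q : Pred B 0ℓ} (P? : Decidable P) (Q? : Decidable Q)
         {f : A → B} (f-inj : Injective _≡_ _≡_ f) where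

  length-filter-<-map : ∀ {xs ys x₀} → Unique xs →
    (∀ {x} → P x → f x ∈ₗ ys × Q (f x)) → ¬ P x₀ → f x₀ ∈ₗ ys → Q (f x₀) →
    length (filter P? xs) < length (filter Q? ys)
  length-filter-<-map {xs} {ys} {x₀} xs! P⇒Q ¬Px₀ fx₀∈ys Qfx₀ = begin-strict
    length (filter P? xs)          ≡⟨ length-map f (filter P? xs) ⟨
    length (map f (filter P? xs))  <⟨ ⊆⇒length≤ (fx₀∉ ∷ fPxs!) ⊆Qys ⟩
    length (filter Q? ys)          ∎
    where
    open ≤-Reasoning
    fPxs! : Unique (map f (filter P? xs))
    fPxs! = Unique.map⁺ f-inj (Unique.filter⁺ P? xs!)
    fx₀∉ : All (f x₀ ≢_) (map f (filter P? xs))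
    fx₀∉ = All.tabulate λ z∈ fx₀≡z → let x , x∈ , z≡fx = ∈-map⁻ f z∈ in
      ¬Px₀ (subst P (≡-sym (f-inj (trans fx₀≡z z≡fx))) (proj₂ (∈-filter⁻ P? {xs = xs} x∈)))
    ⊆Qys : f x₀ ∷ map f (filter P? xs) ⊆ filter Q? ys
    ⊆Qys (here refl) = ∈-filter⁺ Q? fx₀∈ys Qfx₀
    ⊆Qys (there z∈) with x , x∈ , refl ← ∈-map⁻ f z∈ =
      let fx∈ys , Qfx = P⇒Q (proj₂ (∈-filter⁻ P? {xs = xs} x∈)) in ∈-filter⁺ Q? fx∈ys Qfx

∣p∣>0⇒nonempty : ∀ {n} (p : Subset n) → 0 < ∣ p ∣ → Nonempty p
∣p∣>0⇒nonempty (inside ∷ p)  _      = zero , here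
∣p∣>0⇒nonempty (outside ∷ p) 0<∣p∣ = let x , x∈p = ∣p∣>0⇒nonempty p 0<∣p∣ in suc x , there x∈p

∣p∣>1⇒ordered-pair : ∀ {n} (p : Subset n) → 1 < ∣ p ∣ →
  ∃₂ λ x y → toℕ x < toℕ y × x ∈ p × y ∈ p
∣p∣>1⇒ordered-pair (inside ∷ p) (s≤s 0<∣p∣) =
  let y , y∈p = ∣p∣>0⇒nonempty p 0<∣p∣ in zero , suc y , z<s , here , there y∈p
∣p∣>1⇒ordered-pair (outside ∷ p) 1<∣p∣ =
  let x , y , x<y , x∈p , y∈p = ∣p∣>1⇒ordered-pair p 1<∣p∣ in
  suc x , suc y , s<s x<y , there x∈p , there y∈p

pairwise-equal⇒∣p∣≤1 : ∀ {n} (p : Subset n) → (∀ {x y} → x ∈ p → y ∈ p → x ≡ y) → ∣ p ∣ ≤ 1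
pairwise-equal⇒∣p∣≤1 p all-equal = ≮⇒≥ λ 1<∣p∣ →
  let x , y , x<y , x∈p , y∈p = ∣p∣>1⇒ordered-pair p 1<∣p∣ in
  <⇒≢ x<y (cong toℕ (all-equal x∈p y∈p))

∣p++q∣≡∣p∣+∣q∣ : ∀ {m n} (p : Subset m) (q : Subset n) → ∣ p ++ q ∣ ≡ ∣ p ∣ + ∣ q ∣
∣p++q∣≡∣p∣+∣q∣ []            q = refl
∣p++q∣≡∣p∣+∣q∣ (inside ∷ p)  q = cong suc (∣p++q∣≡∣p∣+∣q∣ p q)
∣p++q∣≡∣p∣+∣q∣ (outside ∷ p) q = ∣p++q∣≡∣p∣+∣q∣ p q

x↑ˡ∈p++q⁺ : ∀ {m n} {p : Subset m} {x} (q : Subset n) → x ∈ p → x ↑ˡ n ∈ p ++ q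
x↑ˡ∈p++q⁺ q here        = here
x↑ˡ∈p++q⁺ q (there x∈p) = there (x↑ˡ∈p++q⁺ q x∈p)

x↑ˡ∈p++q⁻ : ∀ {m n} (p : Subset m) {q : Subset n} {x} → x ↑ˡ n ∈ p ++ q → x ∈ p
x↑ˡ∈p++q⁻ (inside ∷ p) {x = zero}  here          = here
x↑ˡ∈p++q⁻ (_ ∷ p)      {x = suc x} (there x∈p++q) = there (x↑ˡ∈p++q⁻ p x∈p++q)

length-endpoints : ∀ {n} (M : List (Fin n × Fin n)) → length (endpoints M) ≡ 2 * length M
length-endpoints []            = refl
length-endpoints ((u , v) ∷ M) =
  trans (cong (2 +_) (length-endpoints M)) (≡-sym (*-suc 2 (length M)))

endpoints-map : ∀ {n n'} (f : Fin n → Fin n') (M : List (Fin n × Fin n)) →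
  endpoints (map (Product.map f f) M) ≡ map f (endpoints M)
endpoints-map f []            = refl
endpoints-map f ((u , v) ∷ M) = cong (λ ws → f u ∷ f v ∷ ws) (endpoints-map f M)

module _ {n n'} (G : Graph n) (G' : Graph n') {f : Fin n → Fin n'} (f-inj : Injective _≡_ _≡_ f)
         (f-hom : ∀ {i j} → adj G i j ≡ true → adj G' (f i) (f j) ≡ true) where

  IsMatching-map : ∀ {M} → IsMatching G M → IsMatching G' (map (Product.map f f) M)
  IsMatching-map {M} (edges , distinct) =
    All.map⁺ (All.map (λ { {u , v} → f-hom }) edges) ,
    subst Unique (≡-sym (endpoints-map f M)) (Unique.map⁺ f-inj distinct)

IsMatching⇒2*length≤ : ∀ {n} (G : Graph n) (C : List (Fin n)) →
  (∀ {x y} → adj G x y ≡ true → x ∈ₗ C) → ∀ {M} → IsMatching G M → 2 * length M ≤ length C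
IsMatching⇒2*length≤ G C covers {M} (edges , distinct) = begin
  2 * length M           ≡⟨ length-endpoints M ⟨
  length (endpoints M)   ≤⟨ ⊆⇒length≤ distinct (All.lookup (endpoints-covered edges)) ⟩
  length C               ∎
  where
  open ≤-Reasoning
  endpoints-covered : ∀ {M} → All (λ { (u , v) → adj G u v ≡ true }) M → All (_∈ₗ C) (endpoints M)
  endpoints-covered [] = []
  endpoints-covered {(u , v) ∷ M} (uv∈E ∷ edges) =
    covers uv∈E ∷ covers (trans (Graph.sym G v u) uv∈E) ∷ endpoints-covered edges

independenceNumber>1⇒nonedge : ∀ {n a} (G : Graph n) → IndependenceNumber G a → 1 < a →
  ∃₂ λ u v → toℕ u < toℕ v × adj G u v ≡ false
independenceNumber>1⇒nonedge G ((S , S-indep , ∣S∣≡a) , _) 1<a =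
  let u , v , u<v , u∈S , v∈S = ∣p∣>1⇒ordered-pair S (subst (1 <_) (≡-sym ∣S∣≡a) 1<a) in
  u , v , u<v , S-indep u v u∈S v∈S

edgeCount-<-cliqueExtension : ∀ {n k} (G : Graph n) (G' : Graph (n + k)) →
  (∀ {i j} → i ≢ j → adj G' (i ↑ˡ k) (j ↑ˡ k) ≡ true) →
  ∀ {u v} → toℕ u < toℕ v → adj G u v ≡ false → edgeCount G < edgeCount G'
edgeCount-<-cliqueExtension {n} {k} G G' clique u<v uv∉E =
  length-filter-<-map _ _ pair↑ˡ-injective
    (Unique.cartesianProduct⁺ (Unique.allFin⁺ n) (Unique.allFin⁺ n))
    (λ { {i , j} (i<j , _) → pair∈ , ↑ˡ-edge i<j })
    (λ { (_ , uv∈E) → subst T uv∉E uv∈E })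
    pair∈ (↑ˡ-edge u<v)
  where
  pair∈ : ∀ {i j : Fin (n + k)} → (i , j) ∈ₗ cartesianProduct (allFin (n + k)) (allFin (n + k))
  pair∈ = ∈-cartesianProduct⁺ (∈-allFin _) (∈-allFin _)

  pair↑ˡ-injective : Injective _≡_ _≡_ (Product.map (_↑ˡ k) (_↑ˡ k))
  pair↑ˡ-injective e =
    let i≡ , j≡ = ,-injective e in cong₂ _,_ (↑ˡ-injective k _ _ i≡) (↑ˡ-injective k _ _ j≡)

  ↑ˡ-edge : ∀ {i j} → toℕ i < toℕ j → toℕ (i ↑ˡ k) < toℕ (j ↑ˡ k) × T (adj G' (i ↑ˡ k) (j ↑ˡ k))
  ↑ˡ-edge {i} {j} i<j =
    subst₂ _<_ (≡-sym (toℕ-↑ˡ i k)) (≡-sym (toℕ-↑ˡ j k)) i<j ,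
    Equivalence.from T-≡ (clique (<⇒≢ i<j ∘ cong toℕ))

private
  module _ {n k : ℕ} where
    adj⊎ : Fin n ⊎ Fin k → Fin n ⊎ Fin k → Bool
    adj⊎ (inj₁ i) (inj₁ j) = not (does (i ≟ j))
    adj⊎ _        _        = false

    adj⊎-sym : ∀ x y → adj⊎ x y ≡ adj⊎ y x
    adj⊎-sym (inj₁ i) (inj₁ j) with i ≟ j | j ≟ i
    ... | yes _   | yes _   = refl
    ... | no _    | no _    = refl
    ... | yes i≡j | no j≢i  = contradiction (≡-sym i≡j) j≢i
    ... | no i≢j  | yes j≡i = contradiction (≡-sym j≡i) i≢j
    adj⊎-sym (inj₁ _) (inj₂ _) = refl
    adj⊎-sym (inj₂ _) (inj₁ _) = refl
    adj⊎-sym (inj₂ _) (inj₂ _) = refl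

    adj⊎-irrefl : ∀ x → adj⊎ x x ≡ false
    adj⊎-irrefl (inj₁ i) = cong not (dec-true (i ≟ i) refl)
    adj⊎-irrefl (inj₂ _) = refl

-- Kₙ on the vertices i ↑ˡ k and k isolated vertices n ↑ʳ j; kept opaque, so that it is
-- used only through adj-↑ˡ and adj⇒↑ˡ.
opaque
  clique⊎isolated : ∀ n k → Graph (n + k)
  clique⊎isolated n k = record
    { adj      = λ x y → adj⊎ (splitAt n x) (splitAt n y)
    ; sym      = λ x y → adj⊎-sym (splitAt n x) (splitAt n y)
    ; loopless = λ x → adj⊎-irrefl (splitAt n x)
    }

module _ {n k : ℕ} where

  opaque
    unfolding clique⊎isolated

    adj-↑ˡ : ∀ {i j} → i ≢ j → adj (clique⊎isolated n k) (i ↑ˡ k) (j ↑ˡ k) ≡ true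
    adj-↑ˡ {i} {j} i≢j rewrite splitAt-↑ˡ n i k | splitAt-↑ˡ n j k =
      cong not (dec-false (i ≟ j) i≢j)

    adj⇒↑ˡ : ∀ {x y} → adj (clique⊎isolated n k) x y ≡ true →
      ∃₂ λ i j → x ≡ i ↑ˡ k × y ≡ j ↑ˡ k × i ≢ j
    adj⇒↑ˡ {x} {y} xy∈E with splitAt n x in x≡ | splitAt n y in y≡ | xy∈E
    ... | inj₁ i | inj₁ j | ij∈E =
      i , j , ≡-sym (splitAt⁻¹-↑ˡ x≡) , ≡-sym (splitAt⁻¹-↑ˡ y≡) ,
      λ i≡j → contradiction (trans (cong not (≡-sym (dec-true (i ≟ j) i≡j))) ij∈E) λ ()
    ... | inj₁ _ | inj₂ _ | ()
    ... | inj₂ _ | _      | ()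

  clique⊎isolated-independenceNumber : Fin n → IndependenceNumber (clique⊎isolated n k) (suc k)
  clique⊎isolated-independenceNumber x = (⁅ x ⁆ ++ ⊤ , independent , size) , bound
    where
    size : ∣ ⁅ x ⁆ ++ ⊤ {k} ∣ ≡ suc k
    size = trans (∣p++q∣≡∣p∣+∣q∣ ⁅ x ⁆ ⊤) (cong₂ _+_ (∣⁅x⁆∣≡1 x) (∣⊤∣≡n k))

    nonadjacent : ∀ {y z} → y ∈ ⁅ x ⁆ ++ ⊤ → z ∈ ⁅ x ⁆ ++ ⊤ → adj (clique⊎isolated n k) y z ≢ true
    nonadjacent y∈ z∈ yz∈E with adj⇒↑ˡ yz∈E
    ... | i , j , refl , refl , i≢j =
      i≢j (trans (x∈⁅y⁆⇒x≡y x (x↑ˡ∈p++q⁻ ⁅ x ⁆ y∈)) (≡-sym (x∈⁅y⁆⇒x≡y x (x↑ˡ∈p++q⁻ ⁅ x ⁆ z∈))))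

    independent : Independent (clique⊎isolated n k) (⁅ x ⁆ ++ ⊤)
    independent y z y∈ z∈ = ¬-not (nonadjacent y∈ z∈)

    bound : ∀ S → Independent (clique⊎isolated n k) S → ∣ S ∣ ≤ suc k
    bound S S-indep with p , q , refl ← Data.Vec.splitAt n S = begin
      ∣ p ++ q ∣    ≡⟨ ∣p++q∣≡∣p∣+∣q∣ p q ⟩
      ∣ p ∣ + ∣ q ∣ ≤⟨ +-mono-≤ (pairwise-equal⇒∣p∣≤1 p clique-part) (∣p∣≤n q) ⟩
      1 + k         ∎
      where
      open ≤-Reasoning
      clique-part : ∀ {i j} → i ∈ p → j ∈ p → i ≡ j
      clique-part {i} {j} i∈p j∈p = decidable-stable (i ≟ j) λ i≢j →
        let ij∉E = S-indep _ _ (x↑ˡ∈p++q⁺ q i∈p) (x↑ˡ∈p++q⁺ q j∈p) in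
        contradiction (trans (≡-sym (adj-↑ˡ i≢j)) ij∉E) λ ()

clique⊎isolated-matchingNumber : ∀ {n m} k (G : Graph n) → MatchingNumber G m → n < 2 * m + 2 →
  MatchingNumber (clique⊎isolated n k) m
clique⊎isolated-matchingNumber {n} {m} k G ((M , M-matching , ∣M∣≡m) , _) n<2m+2 =
  (map (Product.map (_↑ˡ k) (_↑ˡ k)) M ,
   IsMatching-map G (clique⊎isolated n k) (↑ˡ-injective k _ _) edge↑ˡ M-matching ,
   trans (length-map _ M) ∣M∣≡m) ,
  bound
  where
  edge↑ˡ : ∀ {i j} → adj G i j ≡ true → adj (clique⊎isolated n k) (i ↑ˡ k) (j ↑ˡ k) ≡ true
  edge↑ˡ {i} ij∈E = adj-↑ˡ λ { refl → contradiction (trans (≡-sym ij∈E) (loopless G i)) λ () }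

  clique : List (Fin (n + k))
  clique = map (_↑ˡ k) (allFin n)

  covers : ∀ {x y} → adj (clique⊎isolated n k) x y ≡ true → x ∈ₗ clique
  covers xy∈E with i , _ , refl , _ ← adj⇒↑ˡ xy∈E = ∈-map⁺ (_↑ˡ k) (∈-allFin i)

  bound : ∀ M' → IsMatching (clique⊎isolated n k) M' → length M' ≤ m
  bound M' M'-matching = s≤s⁻¹ (*-cancelˡ-< 2 (length M') (suc m) (begin-strict
    2 * length M'    ≤⟨ IsMatching⇒2*length≤ (clique⊎isolated n k) clique covers M'-matching ⟩
    length clique    ≡⟨ trans (length-map _ (allFin n)) (length-tabulate _) ⟩
    n                <⟨ n<2m+2 ⟩
    2 * m + 2        ≡⟨ trans (+-comm (2 * m) 2) (≡-sym (*-suc 2 m)) ⟩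
    2 * suc m        ∎))
    where open ≤-Reasoning

proposition13 : (a m : ℕ) → 1 < a → 1 ≤ m →
    (n : ℕ) (G : Graph n) → InE₁ a m G → 2 * m + 2 ≤ n
proposition13 (suc k) m 1<a _ n G (αG , νG , maximal) with 2 * m + 2 ≤? n
... | yes 2m+2≤n = 2m+2≤n
... | no 2m+2≰n =
  let u , v , u<v , uv∉E = independenceNumber>1⇒nonedge G αG 1<a
      H = clique⊎isolated n k
  in contradiction
       (maximal (n + k) H (clique⊎isolated-independenceNumber u)
                          (clique⊎isolated-matchingNumber k G νG (≰⇒> 2m+2≰n)))
       (<⇒≱ (edgeCount-<-cliqueExtension G H adj-↑ˡ u<v uv∉E))
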